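{- Let $\Sigma_5=\{0,1,2,3,4\}$ and let $g:\Sigma_5^*\to\{0,1\}^*$ be the morphism $g(0)=011100$, $g(1)=101100$, $g(2)=111000$, $g(3)=110010$, $g(4)=110001$. If $w\in\Sigma_5^*$ is squarefree and contains none of the subwords $02,03,04,13,14,20,24,30,31,41,42,434010$, then the only squares occurring as subwords of $g(w)$ are $00$, $11$ and $0101$.
   Context: A square is a nonempty word $xx$; squarefree means containing no square as a (contiguous) subword. -}

module Defs where

open import Data.Fin using (Fin; #_)
open import Data.Fin.Patterns using (0F; 1F; 2F; 3F; 4F)
open import Data.List using (List; []; _∷_; _++_; concatMap)
open import Data.Product using (Σ; _×_; ∃-syntax)
open import Relation.Binary.PropositionalEquality using (_≡_)
open import Relation.Nullary using (¬_)

Σ₅ : Set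
Σ₅ = Fin 5

Σ₂ : Set
Σ₂ = Fin 2

Subword : {A : Set} → List A → List A → Set
Subword {A} u w = ∃[ p ] ∃[ s ] (w ≡ p ++ (u ++ s))

IsSquare : {A : Set} → List A → Set
IsSquare {A} u = ∃[ x ] (¬ (x ≡ []) × (u ≡ x ++ x))

Squarefree : {A : Set} → List A → Set
Squarefree w = ∀ u → Subword u w → ¬ IsSquare u

gLetter : Σ₅ → List Σ₂
gLetter 0F = # 0 ∷ # 1 ∷ # 1 ∷ # 1 ∷ # 0 ∷ # 0 ∷ []
gLetter 1F = # 1 ∷ # 0 ∷ # 1 ∷ # 1 ∷ # 0 ∷ # 0 ∷ []
gLetter 2F = # 1 ∷ # 1 ∷ # 1 ∷ # 0 ∷ # 0 ∷ # 0 ∷ []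
gLetter 3F = # 1 ∷ # 1 ∷ # 0 ∷ # 0 ∷ # 1 ∷ # 0 ∷ []
gLetter 4F = # 1 ∷ # 1 ∷ # 0 ∷ # 0 ∷ # 0 ∷ # 1 ∷ []

g : List Σ₅ → List Σ₂
g = concatMap gLetter

Forbidden : List (List Σ₅)
Forbidden =
  (# 0 ∷ # 2 ∷ []) ∷ (# 0 ∷ # 3 ∷ []) ∷ (# 0 ∷ # 4 ∷ []) ∷
  (# 1 ∷ # 3 ∷ []) ∷ (# 1 ∷ # 4 ∷ []) ∷ (# 2 ∷ # 0 ∷ []) ∷
  (# 2 ∷ # 4 ∷ []) ∷ (# 3 ∷ # 0 ∷ []) ∷ (# 3 ∷ # 1 ∷ []) ∷
  (# 4 ∷ # 1 ∷ []) ∷ (# 4 ∷ # 2 ∷ []) ∷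
  (# 4 ∷ # 3 ∷ # 4 ∷ # 0 ∷ # 1 ∷ # 0 ∷ []) ∷ []

AllowedSquares : List (List Σ₂)
AllowedSquares =
  (# 0 ∷ # 0 ∷ []) ∷ (# 1 ∷ # 1 ∷ []) ∷ (# 0 ∷ # 1 ∷ # 0 ∷ # 1 ∷ []) ∷ []

-- Squares xx of g(w) with |x| ≤ 18 are local: after dropping whole blocks of g(w) they lie in the
-- image of a factor of w of length 7, so they are all found by a finite search over valid words.
-- Longer squares do not occur because of synchronisation: inside the image of a valid word, a factor
-- of length 19 determines its position modulo 6 (again a finite search, over words of length 4).
-- Applied to the first 19 letters of the two copies of x this gives 6 ∣ |x|, so xx desubstitutes.
-- If it starts at a block boundary, the preimages of the two halves coincide and w has a square.
-- Otherwise xx starts at offset 0 < t < 6 in the block of a letter a, and since 6 ∣ |x| the positions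
-- |x| and 2|x| further on lie at offset t in the blocks of letters b and c, with w = aUbUcD. Comparing
-- blocks, g(a) and g(b) agree after offset t and g(b) and g(c) agree before it, which for this g
-- forces a = b or b = c: the square aUaU or (Ub)(Ub) in w.
module Submission where

open import Defs
open import Data.List using (List)
open import Data.List.Membership.Propositional using (_∈_)
open import Data.List.Relation.Unary.All using (All)
open import Relation.Nullary using (¬_)

open import Data.Empty using (⊥; ⊥-elim)
open import Data.Fin using (Fin; toℕ; fromℕ<) renaming (_≟_ to _≟ᶠ_)
open import Data.Fin.Properties using (all?; any?; toℕ-fromℕ<)
open import Data.List
  using ([]; _∷_; _++_; [_]; length; take; drop; _ʳ++_; reverse; concatMap; map; filter; head; tails;
         allFin; upTo; applyUpTo)
open import Data.List.Properties
  using (≡-dec; ∷-injective; ++-assoc; ++-identityʳ; ++-conicalˡ; ++-conicalʳ; length-++; length-++-≤ˡ;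
         length-take; length-drop; length-reverse; reverse-involutive; take++drop≡id; concatMap-++)
import Data.List.Relation.Unary.All as All
open import Data.List.Relation.Unary.All.Properties using (All¬⇒¬Any)
open import Data.List.Relation.Unary.Any as Any using (Any)
open import Data.List.Membership.DecPropositional (≡-dec (_≟ᶠ_ {2})) using (_∈?_)
open import Data.List.Membership.Propositional.Properties using (∈-upTo⁺; ∈-applyUpTo⁺)
open import Data.Maybe using (fromMaybe)
open import Data.Nat using (ℕ; zero; suc; _+_; _*_; _⊓_; _≤_; _<_; s≤s; z≤n; s≤s⁻¹; _≤?_)
open import Data.Nat.DivMod using (_/_; m/n*n≤m; m%n≡m∸m/n*n; m%n<n)
open import Data.Nat.Properties
  using (≤-trans; <⇒≤; <⇒≢; ≰⇒>; m≤m+n; m+n≮m; m≤n⇒m⊓n≡m; m⊓n≤m; ⊓-glb; *-distribʳ-⊓;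
         *-cancelʳ-≤; +-assoc; +-comm; +-identityʳ; +-cancelˡ-≡; +-monoʳ-≤; +-monoˡ-≤; +-mono-≤;
         m+[n∸m]≡n; suc-injective; 0≢1+n; module ≤-Reasoning)
  renaming (_≟_ to _≟ⁿ_)
open import Data.Product using (∃; ∃₂; _×_; _,_; proj₁; proj₂)
import Data.Product as Product
open import Data.Sum using (_⊎_; inj₁; inj₂)
open import Data.Unit using (tt)
open import Function using (_∘_)
open import Relation.Binary.PropositionalEquality
  using (_≡_; refl; sym; trans; cong; cong₂; subst; module ≡-Reasoning)
open import Relation.Nullary using (Dec; yes; no)
open import Relation.Nullary.Decidable using (_×-dec_; _⊎-dec_; _→-dec_; ¬?; toWitness)
open import Relation.Unary using (Decidable)

module _ {A : Set} where

  take-++-length : ∀ {n} (xs ys : List A) → length xs ≡ n → take n (xs ++ ys) ≡ xs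
  take-++-length []       ys refl = refl
  take-++-length (x ∷ xs) ys refl = cong (x ∷_) (take-++-length xs ys refl)

  drop-++-length : ∀ {n} (xs ys : List A) → length xs ≡ n → drop n (xs ++ ys) ≡ ys
  drop-++-length []       ys refl = refl
  drop-++-length (x ∷ xs) ys refl = drop-++-length xs ys refl

  length-take-≤ : ∀ k (xs : List A) → length (take k xs) ≤ k
  length-take-≤ k xs = subst (_≤ k) (sym (length-take k xs)) (m⊓n≤m k (length xs))

  ++-injective : ∀ xs ys {zs ws : List A} → length xs ≡ length zs →
                 xs ++ ys ≡ zs ++ ws → xs ≡ zs × ys ≡ ws
  ++-injective []       ys {[]}     _   eq = refl , eq
  ++-injective (x ∷ xs) ys {z ∷ zs} len eq with ∷-injective eq
  ... | refl , eq′ = Product.map₁ (cong (x ∷_)) (++-injective xs ys (suc-injective len) eq′)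

  ++-levi : ∀ xs ys zs {ws : List A} → length zs ≤ length xs → xs ++ ys ≡ zs ++ ws →
            ∃ λ us → xs ≡ zs ++ us × ws ≡ us ++ ys
  ++-levi xs       ys []       _           eq = xs , refl , sym eq
  ++-levi (x ∷ xs) ys (z ∷ zs) (s≤s zs≤xs) eq with ∷-injective eq
  ... | refl , eq′ = Product.map₂ (Product.map₁ (cong (x ∷_))) (++-levi xs ys zs zs≤xs eq′)

  split-by-length : ∀ n (xs : List A) {m} → length xs ≡ n + m →
                    ∃₂ λ ys zs → xs ≡ ys ++ zs × length ys ≡ n × length zs ≡ m
  split-by-length zero    xs       eq = [] , xs , refl , refl , eq
  split-by-length (suc n) (x ∷ xs) eq =
    let (ys , zs , xs≡ , |ys|≡ , |zs|≡) = split-by-length n xs (suc-injective eq)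
    in x ∷ ys , zs , cong (x ∷_) xs≡ , cong suc |ys|≡ , |zs|≡

  square-rotate : ∀ {α ws x s : List A} → α ++ ws ≡ x ++ x ++ s → length α ≤ length x →
                  ∃ λ x₁ → x ≡ α ++ x₁ × ws ≡ (x₁ ++ α) ++ x₁ ++ s
  square-rotate {α} {ws} {x} {s} eq α≤x =
    let (x₁ , x≡ , ws≡) = ++-levi x (x ++ s) α α≤x (sym eq)
    in x₁ , x≡ , (begin
      ws                      ≡⟨ ws≡ ⟩
      x₁ ++ x ++ s            ≡⟨ cong (λ z → x₁ ++ z ++ s) x≡ ⟩
      x₁ ++ (α ++ x₁) ++ s    ≡⟨ cong (x₁ ++_) (++-assoc α x₁ s) ⟩
      x₁ ++ α ++ x₁ ++ s      ≡⟨ sym (++-assoc x₁ α _) ⟩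
      (x₁ ++ α) ++ x₁ ++ s    ∎)
    where open ≡-Reasoning

  take-drop-square : ∀ n (w : List A) → take n (drop n w) ≡ take n w →
                     w ≡ (take n w ++ take n w) ++ drop n (drop n w)
  take-drop-square n w eq = begin
    w                                                   ≡⟨ sym (take++drop≡id n w) ⟩
    take n w ++ drop n w                                ≡⟨ cong (take n w ++_) (sym (take++drop≡id n _)) ⟩
    take n w ++ take n (drop n w) ++ drop n (drop n w)  ≡⟨ cong (λ z → take n w ++ z ++ drop n (drop n w)) eq ⟩
    take n w ++ take n w ++ drop n (drop n w)           ≡⟨ sym (++-assoc (take n w) _ _) ⟩
    (take n w ++ take n w) ++ drop n (drop n w)         ∎
    where open ≡-Reasoning

  subword-trans : ∀ {u v w : List A} → Subword u v → Subword v w → Subword u w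
  subword-trans {u} (p , s , refl) (p′ , s′ , refl) = p′ ++ p , s ++ s′ , (begin
    p′ ++ (p ++ u ++ s) ++ s′     ≡⟨ cong (p′ ++_) (++-assoc p (u ++ s) s′) ⟩
    p′ ++ p ++ (u ++ s) ++ s′     ≡⟨ cong (λ z → p′ ++ p ++ z) (++-assoc u s s′) ⟩
    p′ ++ p ++ u ++ s ++ s′       ≡⟨ sym (++-assoc p′ p _) ⟩
    (p′ ++ p) ++ u ++ s ++ s′     ∎)
    where open ≡-Reasoning

  prefix-subword : ∀ {f xs : List A} → take (length f) xs ≡ f → Subword f xs
  prefix-subword {f} {xs} eq =
    [] , drop (length f) xs , trans (sym (take++drop≡id (length f) xs)) (cong (_++ drop (length f) xs) eq)

  take-subword : ∀ n (xs : List A) → Subword (take n xs) xs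
  take-subword n xs = [] , drop n xs , sym (take++drop≡id n xs)

  drop-subword : ∀ n (xs : List A) → Subword (drop n xs) xs
  drop-subword n xs =
    take n xs , [] , trans (sym (take++drop≡id n xs)) (cong (take n xs ++_) (sym (++-identityʳ _)))

  square-factor⇒¬squarefree : ∀ {w : List A} q u r → w ≡ q ++ (u ++ u) ++ r → ¬ u ≡ [] →
                              ¬ Squarefree w
  square-factor⇒¬squarefree q u r refl u≢[] squarefree =
    squarefree (u ++ u) (q , r , refl) (u , u≢[] , refl)

  straddled-square : ∀ {w : List A} {a b c} U D → w ≡ a ∷ U ++ b ∷ U ++ c ∷ D → a ≡ b ⊎ b ≡ c →
                     ¬ Squarefree w
  straddled-square {a = a} {c = c} U D w≡ (inj₁ refl) =
    square-factor⇒¬squarefree [] (a ∷ U) (c ∷ D) (trans w≡ (cong (a ∷_) (sym (++-assoc U (a ∷ U) _)))) λ ()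
  straddled-square {a = a} {b = b} U D w≡ (inj₂ refl) =
    square-factor⇒¬squarefree [ a ] (U ++ [ b ]) D (trans w≡ (cong (a ∷_) (sym UbUbD≡)))
      λ eq → [b]≢[] (++-conicalʳ U [ b ] eq)
    where
      [b]≢[] : ¬ [ b ] ≡ []
      [b]≢[] ()
      UbUbD≡ : ((U ++ [ b ]) ++ U ++ [ b ]) ++ D ≡ U ++ b ∷ U ++ b ∷ D
      UbUbD≡ = begin
        ((U ++ [ b ]) ++ U ++ [ b ]) ++ D  ≡⟨ ++-assoc (U ++ [ b ]) _ D ⟩
        (U ++ [ b ]) ++ (U ++ [ b ]) ++ D  ≡⟨ ++-assoc U [ b ] _ ⟩
        U ++ b ∷ (U ++ [ b ]) ++ D         ≡⟨ cong (λ z → U ++ b ∷ z) (++-assoc U [ b ] D) ⟩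
        U ++ b ∷ U ++ b ∷ D                ∎
        where open ≡-Reasoning

module UniformMorphism {A B : Set} (h : A → List B) (ℓ : ℕ) (length-h : ∀ a → length (h a) ≡ suc ℓ)
  where

  h* : List A → List B
  h* = concatMap h

  length-h* : ∀ u → length (h* u) ≡ length u * suc ℓ
  length-h* []      = refl
  length-h* (a ∷ u) = trans (length-++ (h a)) (cong₂ _+_ (length-h a) (length-h* u))

  h-nonempty : ∀ a → ¬ h a ≡ []
  h-nonempty a ha≡[] = 0≢1+n (trans (cong length (sym ha≡[])) (length-h a))

  h*-empty : ∀ u → h* u ≡ [] → u ≡ []
  h*-empty []      _  = refl
  h*-empty (a ∷ u) eq = ⊥-elim (h-nonempty a (++-conicalˡ (h a) (h* u) eq))

  h*-take++drop : ∀ j w → h* (take j w) ++ h* (drop j w) ≡ h* w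
  h*-take++drop j w = trans (sym (concatMap-++ h (take j w) (drop j w))) (cong h* (take++drop≡id j w))

  h*-take : ∀ j w {P S} → h* w ≡ P ++ S → length P ≡ j * suc ℓ →
            h* (take j w) ≡ P × h* (drop j w) ≡ S
  h*-take j w {P} {S} eq |P|≡ = ++-injective _ _ length-eq (trans (h*-take++drop j w) eq)
    where
      j≤|w| : j ≤ length w
      j≤|w| = *-cancelʳ-≤ j (length w) (suc ℓ) (begin
        j * suc ℓ         ≡⟨ sym |P|≡ ⟩
        length P          ≤⟨ length-++-≤ˡ P ⟩
        length (P ++ S)   ≡⟨ cong length (sym eq) ⟩
        length (h* w)     ≡⟨ length-h* w ⟩
        length w * suc ℓ  ∎)
        where open ≤-Reasoning
      length-eq : length (h* (take j w)) ≡ length P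
      length-eq = trans (length-h* (take j w))
                    (trans (cong (_* suc ℓ) (trans (length-take j w) (m≤n⇒m⊓n≡m j≤|w|))) (sym |P|≡))

  h*-window : ∀ k w {P S} → h* w ≡ P ++ S → length P ≤ k * suc ℓ → ∃ λ S′ → h* (take k w) ≡ P ++ S′
  h*-window k w {P} {S} eq |P|≤ =
    let (S′ , take≡ , _) = ++-levi (h* (take k w)) (h* (drop k w)) P fits (trans (h*-take++drop k w) eq)
    in S′ , take≡
    where
      |P|≤|h*w| : length P ≤ length w * suc ℓ
      |P|≤|h*w| = subst (length P ≤_) (trans (cong length (sym eq)) (length-h* w)) (length-++-≤ˡ P)
      fits : length P ≤ length (h* (take k w))
      fits = begin
        length P                            ≤⟨ ⊓-glb |P|≤ |P|≤|h*w| ⟩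
        (k * suc ℓ) ⊓ (length w * suc ℓ)    ≡⟨ sym (*-distribʳ-⊓ (suc ℓ) k (length w)) ⟩
        (k ⊓ length w) * suc ℓ              ≡⟨ cong (_* suc ℓ) (sym (length-take k w)) ⟩
        length (take k w) * suc ℓ           ≡⟨ sym (length-h* (take k w)) ⟩
        length (h* (take k w))              ∎
        where open ≤-Reasoning

  h*-realign : ∀ w {P S} → h* w ≡ P ++ S →
               ∃₂ λ j P′ → h* (drop j w) ≡ P′ ++ S × length P ≡ j * suc ℓ + length P′ × length P′ < suc ℓ
  h*-realign w {P} {S} eq =
    j , drop n P , proj₂ (h*-take j w {take n P} eq′ length-head) , length-P , length-tail<
    where
      j = length P / suc ℓ
      n = j * suc ℓ
      n≤|P| : n ≤ length P
      n≤|P| = m/n*n≤m (length P) (suc ℓ)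
      eq′ : h* w ≡ take n P ++ drop n P ++ S
      eq′ = trans eq (trans (cong (_++ S) (sym (take++drop≡id n P))) (++-assoc (take n P) _ S))
      length-head : length (take n P) ≡ n
      length-head = trans (length-take n P) (m≤n⇒m⊓n≡m n≤|P|)
      length-P : length P ≡ n + length (drop n P)
      length-P = trans (sym (m+[n∸m]≡n n≤|P|)) (cong (n +_) (sym (length-drop n P)))
      length-tail< : length (drop n P) < suc ℓ
      length-tail< = subst (_< suc ℓ) (trans (m%n≡m∸m/n*n (length P) (suc ℓ)) (sym (length-drop n P)))
                       (m%n<n (length P) (suc ℓ))

  h*-head : ∀ v {β S} → h* v ≡ β ++ S → ¬ β ≡ [] → length β ≤ suc ℓ →
            ∃₂ λ b γ → ∃ λ R → v ≡ b ∷ R × h b ≡ β ++ γ × S ≡ γ ++ h* R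
  h*-head []      eq β≢[] _ = ⊥-elim (β≢[] (++-conicalˡ _ _ (sym eq)))
  h*-head (b ∷ R) {β} eq _ |β|≤L =
    let (γ , hb≡ , S≡) = ++-levi (h b) (h* R) β (subst (length β ≤_) (sym (length-h b)) |β|≤L) eq
    in b , γ , R , refl , hb≡ , S≡

  h*-straddle : ∀ i w {U′ β S} → h* w ≡ U′ ++ β ++ S → length U′ ≡ i * suc ℓ → ¬ β ≡ [] →
                length β ≤ suc ℓ →
                ∃₂ λ b γ → ∃ λ R → w ≡ take i w ++ b ∷ R × h* (take i w) ≡ U′ × h b ≡ β ++ γ × S ≡ γ ++ h* R
  h*-straddle i w eq |U′|≡ β≢[] |β|≤L =
    let (take≡ , drop≡) = h*-take i w eq |U′|≡
        (b , γ , R , drop-w≡ , hb≡ , S≡) = h*-head (drop i w) drop≡ β≢[] |β|≤L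
    in b , γ , R , trans (sym (take++drop≡id i w)) (cong (take i w ++_) drop-w≡) , take≡ , hb≡ , S≡

  RigidAt : ℕ → Set
  RigidAt t = ∀ a b c → drop t (h a) ≡ drop t (h b) → take t (h b) ≡ take t (h c) → a ≡ b ⊎ b ≡ c

  module _ (h-injective : ∀ {a b} → h a ≡ h b → a ≡ b) where

    h*-injective : ∀ {u v} → h* u ≡ h* v → u ≡ v
    h*-injective {[]}    {[]}    _  = refl
    h*-injective {[]}    {b ∷ v} eq = ⊥-elim (h-nonempty b (++-conicalˡ (h b) (h* v) (sym eq)))
    h*-injective {a ∷ u} {[]}    eq = ⊥-elim (h-nonempty a (++-conicalˡ (h a) (h* u) eq))
    h*-injective {a ∷ u} {b ∷ v} eq =
      let (ha≡hb , hu≡hv) = ++-injective (h a) (h* u) (trans (length-h a) (sym (length-h b))) eq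
      in cong₂ _∷_ (h-injective ha≡hb) (h*-injective hu≡hv)

    h*-aligned-square : ∀ i w {x s} → h* w ≡ x ++ x ++ s → length x ≡ suc i * suc ℓ → ¬ Squarefree w
    h*-aligned-square i w {x} eq |x|≡ =
      let j = suc i
          (hu≡x , rest) = h*-take j w {x} eq |x|≡
          (hu′≡x , _) = h*-take j (drop j w) rest |x|≡
          u≢[] u≡[] = 0≢1+n (trans (cong length (trans (cong h* (sym u≡[])) hu≡x)) |x|≡)
      in square-factor⇒¬squarefree [] (take j w) _
           (take-drop-square j w (h*-injective (trans hu′≡x (sym hu≡x)))) u≢[]

    h*-shifted-square : ∀ i v {U′ β α s} → h* v ≡ (U′ ++ β ++ α) ++ U′ ++ β ++ s →
                        length U′ ≡ i * suc ℓ → ¬ β ≡ [] → length β + length α ≡ suc ℓ →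
                        ∃₂ λ b c → ∃₂ λ U D → v ≡ U ++ b ∷ U ++ c ∷ D ×
                          drop (length β) (h b) ≡ α × take (length β) (h b) ≡ take (length β) (h c)
    h*-shifted-square i v {U′} {β} {α} {s} eq |U′|≡ β≢[] |β|+|α|≡L =
      let (first , second) = h*-take (suc i) v {U′ ++ β ++ α} eq |U′++β++α|≡
          (b , γ , R , take≡ , hU≡ , hb≡ , α≡) = h*-straddle i (take (suc i) v) {U′} first |U′|≡ β≢[] |β|≤L
          (c , _ , D , drop≡ , hC≡ , hc≡ , _) = h*-straddle i (drop (suc i) v) {U′} second |U′|≡ β≢[] |β|≤L
          (γ≡α , hR≡[]) = ++-injective γ (h* R) (|γ|≡|α| hb≡) (trans (sym α≡) (sym (++-identityʳ α)))
          U = take i (take (suc i) v)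
          v≡ = begin
            v                                                 ≡⟨ sym (take++drop≡id (suc i) v) ⟩
            take (suc i) v ++ drop (suc i) v                  ≡⟨ cong₂ _++_ take≡ drop≡ ⟩
            (U ++ b ∷ R) ++ take i (drop (suc i) v) ++ c ∷ D  ≡⟨ cong₂ (λ r C → (U ++ b ∷ r) ++ C ++ c ∷ D)
                                                                   (h*-empty R hR≡[])
                                                                   (h*-injective (trans hC≡ (sym hU≡))) ⟩
            (U ++ [ b ]) ++ U ++ c ∷ D                        ≡⟨ ++-assoc U [ b ] _ ⟩
            U ++ b ∷ U ++ c ∷ D                               ∎
      in b , c , U , D , v≡ ,
         trans (cong (drop (length β)) hb≡) (trans (drop-++-length β γ refl) γ≡α) ,
         trans (trans (cong (take (length β)) hb≡) (take-++-length β γ refl))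
               (sym (trans (cong (take (length β)) hc≡) (take-++-length β _ refl)))
      where
        open ≡-Reasoning
        |U′++β++α|≡ : length (U′ ++ β ++ α) ≡ suc i * suc ℓ
        |U′++β++α|≡ = trans (length-++ U′)
                        (trans (cong₂ _+_ |U′|≡ (trans (length-++ β) |β|+|α|≡L)) (+-comm _ (suc ℓ)))
        |β|≤L : length β ≤ suc ℓ
        |β|≤L = subst (length β ≤_) |β|+|α|≡L (m≤m+n _ _)
        |γ|≡|α| : ∀ {b γ} → h b ≡ β ++ γ → length γ ≡ length α
        |γ|≡|α| {b} hb≡ = +-cancelˡ-≡ (length β) _ _
          (trans (sym (length-++ β)) (trans (cong length (sym hb≡)) (trans (length-h b) (sym |β|+|α|≡L))))

    -- Rotating xx by the tail α of the block where it starts yields the aligned factor (x₁ α)(x₁ ⋯)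
    -- of h* w′.
    h*-unaligned-square : ∀ i w {p x s} → RigidAt (length p) → h* w ≡ p ++ x ++ x ++ s →
                          0 < length p → length p < suc ℓ → length x ≡ suc i * suc ℓ → ¬ Squarefree w
    h*-unaligned-square i w {p} {x} {s} rigid eq 0<|p| |p|<L |x|≡ =
      let (a , α , w′ , w≡ , _ , ha≡ , xxs≡) =
            h*-straddle 0 w {[]} {p} {x ++ x ++ s} eq refl p≢[] (<⇒≤ |p|<L)
          (x₁ , x≡ , hw′≡) = square-rotate {x = x} {s = s} (sym xxs≡) (|α|≤|x| ha≡)
          (U′ , β , x₁≡ , |U′|≡ , |β|≡|p|) = split-by-length (i * suc ℓ) x₁ (|x₁|≡ ha≡ x≡)
          hw′≡′ = trans (subst (λ z → h* w′ ≡ (z ++ α) ++ z ++ s) x₁≡ hw′≡)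
                    (cong₂ _++_ (++-assoc U′ β α) (++-assoc U′ β s))
          β≢[] β≡[] = <⇒≢ 0<|p| (trans (sym (cong length β≡[])) |β|≡|p|)
          |β|+|α|≡L = trans (cong (_+ length α) |β|≡|p|) (trans (+-comm _ (length α)) (|α|+|p|≡L ha≡))
          (b , c , U , D , w′≡ , drop-b≡α , take-b≡take-c) =
            h*-shifted-square i w′ {U′} {β} {α} {s} hw′≡′ |U′|≡ β≢[] |β|+|α|≡L
          drop-a≡α = trans (cong (drop (length β)) ha≡) (drop-++-length p α (sym |β|≡|p|))
      in straddled-square U D (trans w≡ (cong (a ∷_) w′≡))
           (subst RigidAt (sym |β|≡|p|) rigid a b c (trans drop-a≡α (sym drop-b≡α)) take-b≡take-c)
      where
        p≢[] : ¬ p ≡ []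
        p≢[] p≡[] = <⇒≢ 0<|p| (sym (cong length p≡[]))
        |α|+|p|≡L : ∀ {a α} → h a ≡ p ++ α → length α + length p ≡ suc ℓ
        |α|+|p|≡L {a} {α} ha≡ =
          trans (+-comm (length α) _) (trans (sym (length-++ p)) (trans (cong length (sym ha≡)) (length-h a)))
        |α|≤|x| : ∀ {a α} → h a ≡ p ++ α → length α ≤ length x
        |α|≤|x| {a} {α} ha≡ =
          ≤-trans (subst (length α ≤_) (|α|+|p|≡L ha≡) (m≤m+n _ _)) (subst (suc ℓ ≤_) (sym |x|≡) (m≤m+n _ _))
        |x₁|≡ : ∀ {a α x₁} → h a ≡ p ++ α → x ≡ α ++ x₁ → length x₁ ≡ i * suc ℓ + length p
        |x₁|≡ {a} {α} {x₁} ha≡ x≡ = trans (+-cancelˡ-≡ (length α) _ _ (begin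
          length α + length x₁                ≡⟨ sym (length-++ α) ⟩
          length (α ++ x₁)                    ≡⟨ cong length (sym x≡) ⟩
          length x                            ≡⟨ |x|≡ ⟩
          suc ℓ + i * suc ℓ                   ≡⟨ cong (_+ i * suc ℓ) (sym (|α|+|p|≡L ha≡)) ⟩
          length α + length p + i * suc ℓ     ≡⟨ +-assoc (length α) _ _ ⟩
          length α + (length p + i * suc ℓ)   ∎)) (+-comm (length p) _)
          where open ≡-Reasoning

    h*-square-desubstitutes : (∀ t → t < suc ℓ → RigidAt t) → ∀ i w {p x s} → h* w ≡ p ++ x ++ x ++ s →
                              length p < suc ℓ → length x ≡ suc i * suc ℓ → ¬ Squarefree w
    h*-square-desubstitutes rigid i w {[]}    {x}     eq _     |x|≡ = h*-aligned-square i w {x} eq |x|≡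
    h*-square-desubstitutes rigid i w {q ∷ p} {x} {s} eq |p|<L |x|≡ =
      h*-unaligned-square i w {q ∷ p} {x} {s} (rigid _ |p|<L) eq (s≤s z≤n) |p|<L |x|≡

length-gLetter : ∀ a → length (gLetter a) ≡ 6
length-gLetter = toWitness {a? = all? λ a → length (gLetter a) ≟ⁿ 6} tt

open UniformMorphism gLetter 5 length-gLetter

gLetter-injective : ∀ {a b} → gLetter a ≡ gLetter b → a ≡ b
gLetter-injective {a} {b} =
  toWitness {a? = all? λ a → all? λ b → ≡-dec _≟ᶠ_ (gLetter a) (gLetter b) →-dec a ≟ᶠ b} tt a b

gLetter-rigid : ∀ t → t < 6 → RigidAt t
gLetter-rigid t t<6 =
  subst RigidAt (toℕ-fromℕ< t<6) (toWitness {a? = all? (rigidAt? ∘ toℕ)} tt (fromℕ< t<6))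
  where
    rigidAt? : ∀ t → Dec (RigidAt t)
    rigidAt? t = all? λ a → all? λ b → all? λ c →
      ≡-dec _≟ᶠ_ _ _ →-dec (≡-dec _≟ᶠ_ _ _ →-dec (a ≟ᶠ b ⊎-dec b ≟ᶠ c))

Valid : List Σ₅ → Set
Valid w = Squarefree w × All (λ f → ¬ Subword f w) Forbidden

valid-subword : ∀ {v w} → Subword v w → Valid w → Valid v
valid-subword v⊑w (squarefree , avoids) =
  (λ u u⊑v → squarefree u (subword-trans u⊑v v⊑w)) ,
  All.map (λ f⋢w f⊑v → f⋢w (subword-trans f⊑v v⊑w)) avoids

SquarePrefix : List Σ₅ → Set
SquarePrefix u = ∃ λ (i : Fin (length u)) → let n = suc (toℕ i) in take n u ≡ take n (drop n u)

ForbiddenPrefix : List Σ₅ → Set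
ForbiddenPrefix u = Any (λ f → take (length f) u ≡ f) Forbidden

BadPrefix : List Σ₅ → Set
BadPrefix u = SquarePrefix u ⊎ ForbiddenPrefix u

badPrefix? : Decidable BadPrefix
badPrefix? u = any? (λ _ → ≡-dec _≟ᶠ_ _ _) ⊎-dec Any.any? (λ _ → ≡-dec _≟ᶠ_ _ _) Forbidden

-- The decidable counterpart of Valid on which the finite searches run.
Admissible : List Σ₅ → Set
Admissible v = All (λ u → ¬ BadPrefix u) (tails v)

admissible? : Decidable Admissible
admissible? v = All.all? (λ u → ¬? (badPrefix? u)) (tails v)

valid⇒¬badPrefix : ∀ {u} → Valid u → ¬ BadPrefix u
valid⇒¬badPrefix {c ∷ u} (squarefree , _) (inj₁ (i , eq)) =
  square-factor⇒¬squarefree [] (take n (c ∷ u)) _ (take-drop-square n (c ∷ u) (sym eq)) (λ ()) squarefree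
  where n = suc (toℕ i)
valid⇒¬badPrefix (_ , avoids) (inj₂ forbidden) = All¬⇒¬Any (All.map (_∘ prefix-subword) avoids) forbidden

valid⇒admissible : ∀ w → Valid w → Admissible w
valid⇒admissible []      valid = valid⇒¬badPrefix valid All.∷ All.[]
valid⇒admissible (c ∷ w) valid =
  valid⇒¬badPrefix valid All.∷ valid⇒admissible w (valid-subword (drop-subword 1 (c ∷ w)) valid)

valid-window : ∀ k w → Valid w → Admissible (take k w)
valid-window k w valid = valid⇒admissible (take k w) (valid-subword (take-subword k w) valid)

admissible-ʳ++ : ∀ r {u} → Admissible (r ʳ++ u) → Admissible u
admissible-ʳ++ []      adm = adm
admissible-ʳ++ (c ∷ r) adm = All.tail (admissible-ʳ++ r adm)

-- A certificate, checked by evaluation, that P holds on all admissible words of length at most k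
-- ending in v: words grow to the left, and a branch is cut as soon as the word begins with a square
-- or a forbidden factor.
PrunedTree : (List Σ₅ → Set) → ℕ → List Σ₅ → Set
PrunedTree P zero    v = P v
PrunedTree P (suc k) v = P v × ((c : Σ₅) → BadPrefix (c ∷ v) ⊎ PrunedTree P k (c ∷ v))

prunedTree? : {P : List Σ₅ → Set} → Decidable P → ∀ k → Decidable (PrunedTree P k)
prunedTree? P? zero    v = P? v
prunedTree? P? (suc k) v = P? v ×-dec all? λ c → badPrefix? (c ∷ v) ⊎-dec prunedTree? P? k (c ∷ v)

prunedTree-sound : ∀ {P} k {v} → PrunedTree P k v →
                   ∀ r → length r ≤ k → Admissible (r ʳ++ v) → P (r ʳ++ v)
prunedTree-sound zero    pv        []      _         _   = pv
prunedTree-sound (suc k) (pv , _)  []      _         _   = pv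
prunedTree-sound (suc k) (_ , ext) (c ∷ r) (s≤s r≤k) adm with ext c
... | inj₁ bad  = ⊥-elim (All.head (admissible-ʳ++ r adm) bad)
... | inj₂ tree = prunedTree-sound k tree r r≤k adm

prunedTree-complete : ∀ {P} k → PrunedTree P k [] → ∀ v → length v ≤ k → Admissible v → P v
prunedTree-complete {P} k tree v v≤k adm =
  subst P (reverse-involutive v)
    (prunedTree-sound k tree (reverse v) (subst (_≤ k) (sym (length-reverse v)) v≤k)
      (subst Admissible (sym (reverse-involutive v)) adm))

-- The length condition rules out y = [], for which the equation holds trivially.
SquarePrefixAllowed : ℕ → List Σ₂ → Set
SquarePrefixAllowed m y =
  take m y ≡ take m (drop m y) → m + m ≤ length y → take m y ++ take m y ∈ AllowedSquares

ShortSquaresAllowed : List Σ₅ → Set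
ShortSquaresAllowed v =
  All (λ o → All (λ m → SquarePrefixAllowed m (drop o (g v))) (applyUpTo suc 18)) (upTo 6)

shortSquaresAllowed? : Decidable ShortSquaresAllowed
shortSquaresAllowed? v = All.all? (λ o → All.all? (λ m →
  ≡-dec _≟ᶠ_ _ _ →-dec ((m + m ≤? _) →-dec (_ ∈? AllowedSquares))) _) _

admissible⇒shortSquaresAllowed : ∀ v → length v ≤ 7 → Admissible v → ShortSquaresAllowed v
admissible⇒shortSquaresAllowed =
  prunedTree-complete 7 (toWitness {a? = prunedTree? shortSquaresAllowed? 7 []} tt)

squarePrefixAllowed⇒allowed : ∀ x s → SquarePrefixAllowed (length x) (x ++ x ++ s) →
                              x ++ x ∈ AllowedSquares
squarePrefixAllowed⇒allowed x s allowed =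
  subst (_∈ AllowedSquares) (cong₂ _++_ first-half first-half)
    (allowed (trans first-half (sym second-half))
      (subst (length x + length x ≤_) (sym (length-++ x)) (+-monoʳ-≤ _ (length-++-≤ˡ x))))
  where
    first-half : take (length x) (x ++ x ++ s) ≡ x
    first-half = take-++-length x _ refl
    second-half : take (length x) (drop (length x) (x ++ x ++ s)) ≡ x
    second-half = trans (cong (take (length x)) (drop-++-length x _ refl)) (take-++-length x s refl)

short-square-allowed : ∀ {w p x s} → Valid w → g w ≡ p ++ (x ++ x) ++ s → length p < 6 → ¬ x ≡ [] →
                       length x ≤ 18 → x ++ x ∈ AllowedSquares
short-square-allowed {x = []} _ _ _ x≢[] _ = ⊥-elim (x≢[] refl)
short-square-allowed {w} {p} {x@(_ ∷ _)} {s} valid eq |p|<6 _ |x|≤18 =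
  let (S′ , window≡) = h*-window 7 w {p ++ x ++ x} eq′ bound
      allowed = admissible⇒shortSquaresAllowed (take 7 w) (length-take-≤ 7 w) (valid-window 7 w valid)
      allowed-at-p = All.lookup (All.lookup allowed (∈-upTo⁺ |p|<6)) (∈-applyUpTo⁺ suc |x|≤18)
      drop≡ = trans (cong (drop (length p)) (trans window≡ (++-assoc p (x ++ x) S′)))
                (trans (drop-++-length p _ refl) (++-assoc x x S′))
  in squarePrefixAllowed⇒allowed x S′ (subst (SquarePrefixAllowed (length x)) drop≡ allowed-at-p)
  where
    eq′ : g w ≡ (p ++ x ++ x) ++ s
    eq′ = trans eq (sym (++-assoc p (x ++ x) s))
    bound : length (p ++ x ++ x) ≤ 7 * 6
    bound = subst (_≤ 42) (sym (trans (length-++ p) (cong (length p +_) (length-++ x))))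
              (+-mono-≤ (<⇒≤ |p|<6) (+-mono-≤ |x|≤18 |x|≤18))

-- The words v of length ⌈|y| / 6⌉ such that y is a prefix of g v.
readings : List Σ₂ → List (List Σ₅)
readings [] = [ [] ]
readings (b₀ ∷ b₁ ∷ b₂ ∷ b₃ ∷ b₄ ∷ b₅ ∷ y) =
  concatMap (λ a → map (a ∷_) (readings y))
    (filter (λ a → ≡-dec _≟ᶠ_ (gLetter a) (b₀ ∷ b₁ ∷ b₂ ∷ b₃ ∷ b₄ ∷ b₅ ∷ [])) (allFin 5))
readings y = map [_] (filter (λ a → ≡-dec _≟ᶠ_ (take (length y) (gLetter a)) y) (allFin 5))

ReadableAt : ℕ → List Σ₂ → Set
ReadableAt o y = Any Admissible (concatMap (λ a → readings (take o (gLetter a) ++ y)) (allFin 5))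

readableAt? : ∀ o → Decidable (ReadableAt o)
readableAt? o y = Any.any? admissible? _

-- Any function of y would serve below. This one is the least offset o < 6 at which y occurs in the
-- image of an admissible word (0 if there is none); the search behind admissible⇒synchronised shows
-- that it is the actual offset of every factor of length 19 of such an image.
phase : List Σ₂ → ℕ
phase y = fromMaybe 0 (head (filter (λ o → readableAt? o y) (upTo 6)))

Synchronised : List Σ₅ → Set
Synchronised v = All (λ o → o + 19 ≤ length (g v) → phase (take 19 (drop o (g v))) ≡ o) (upTo 6)

synchronised? : Decidable Synchronised
synchronised? v = All.all? (λ o → (o + 19 ≤? _) →-dec (_ ≟ⁿ o)) _

admissible⇒synchronised : ∀ v → length v ≤ 4 → Admissible v → Synchronised v
admissible⇒synchronised = prunedTree-complete 4 (toWitness {a? = prunedTree? synchronised? 4 []} tt)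

synchronised-phase : ∀ {v q y S} → Synchronised v → g v ≡ q ++ y ++ S → length q < 6 → length y ≡ 19 →
                     phase y ≡ length q
synchronised-phase {v} {q} {y} {S} sync eq |q|<6 |y|≡19 =
  subst (λ z → phase z ≡ length q) window≡ (All.lookup sync (∈-upTo⁺ |q|<6) fits)
  where
    window≡ : take 19 (drop (length q) (g v)) ≡ y
    window≡ = trans (cong (take 19 ∘ drop (length q)) eq)
                (trans (cong (take 19) (drop-++-length q _ refl)) (take-++-length y S |y|≡19))
    fits : length q + 19 ≤ length (g v)
    fits = begin
      length q + 19              ≡⟨ cong (length q +_) (sym |y|≡19) ⟩
      length q + length y        ≤⟨ +-monoʳ-≤ (length q) (length-++-≤ˡ y) ⟩
      length q + length (y ++ S) ≡⟨ sym (length-++ q) ⟩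
      length (q ++ y ++ S)       ≡⟨ cong length (sym eq) ⟩
      length (g v)               ∎
      where open ≤-Reasoning

valid-phase : ∀ {w q y r} → Valid w → g w ≡ q ++ y ++ r → length q < 6 → 19 ≤ length y →
              phase (take 19 y) ≡ length q
valid-phase {w} {q} {y} {r} valid eq |q|<6 19≤|y| =
  let (S′ , window≡) = h*-window 4 w {q ++ take 19 y} eq′ bound
      sync = admissible⇒synchronised (take 4 w) (length-take-≤ 4 w) (valid-window 4 w valid)
  in synchronised-phase {take 4 w} {q} {take 19 y} {S′} sync (trans window≡ (++-assoc q _ S′)) |q|<6 |take|≡19
  where
    |take|≡19 : length (take 19 y) ≡ 19
    |take|≡19 = trans (length-take 19 y) (m≤n⇒m⊓n≡m 19≤|y|)
    eq′ : g w ≡ (q ++ take 19 y) ++ drop 19 y ++ r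
    eq′ = trans eq (trans (cong (λ z → q ++ z ++ r) (sym (take++drop≡id 19 y)))
            (trans (cong (q ++_) (++-assoc (take 19 y) _ r)) (sym (++-assoc q _ _))))
    bound : length (q ++ take 19 y) ≤ 4 * 6
    bound = subst (_≤ 24) (sym (trans (length-++ q) (cong (length q +_) |take|≡19)))
              (+-monoˡ-≤ 19 (s≤s⁻¹ |q|<6))

position-phase : ∀ {w q y r} → Valid w → g w ≡ q ++ y ++ r → 19 ≤ length y →
                 ∃ λ k → length q ≡ k * 6 + phase (take 19 y)
position-phase {w} {q} {y} {r} valid eq 19≤|y| =
  let (k , q′ , eq′ , |q|≡ , |q′|<6) = h*-realign w {q} {y ++ r} eq
      valid′ = valid-subword (drop-subword k w) valid
  in k , trans |q|≡ (cong (k * 6 +_) (sym (valid-phase {drop k w} {q′} {y} {r} valid′ eq′ |q′|<6 19≤|y|)))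

phase-offset : ∀ {a d φ} k₁ k₂ → a < 6 → 0 < d → a ≡ k₁ * 6 + φ → a + d ≡ k₂ * 6 + φ →
               ∃ λ i → d ≡ suc i * 6
phase-offset {d = d} {φ} zero     zero    _   0<d refl eq =
  ⊥-elim (<⇒≢ 0<d (sym (+-cancelˡ-≡ φ d 0 (trans eq (sym (+-identityʳ φ))))))
phase-offset {d = d} {φ} zero     (suc i) _   _   refl eq = i , +-cancelˡ-≡ φ _ _ (trans eq (+-comm _ φ))
phase-offset             (suc k₁) _       a<6 _   refl _  = ⊥-elim (m+n≮m 6 _ a<6)

long-square-impossible : ∀ {w p x s} → Valid w → g w ≡ p ++ (x ++ x) ++ s → length p < 6 →
                         19 ≤ length x → ⊥
long-square-impossible {w} {p} {x} {s} valid eq |p|<6 19≤|x| =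
  let (k₁ , |p|≡) = position-phase {w} {p} {x} valid eq₁ 19≤|x|
      (k₂ , |p++x|≡) = position-phase {w} {p ++ x} {x} valid eq₂ 19≤|x|
      (i , |x|≡) = phase-offset k₁ k₂ |p|<6 (≤-trans (s≤s z≤n) 19≤|x|) |p|≡ (trans (sym (length-++ p)) |p++x|≡)
  in h*-square-desubstitutes gLetter-injective gLetter-rigid i w {p} {x} {s} eq₁ |p|<6 |x|≡ (proj₁ valid)
  where
    eq₁ : g w ≡ p ++ x ++ x ++ s
    eq₁ = trans eq (cong (p ++_) (++-assoc x x s))
    eq₂ : g w ≡ (p ++ x) ++ x ++ s
    eq₂ = trans eq₁ (sym (++-assoc p x _))

theorem10 : (w : List Σ₅) → Squarefree w → All (λ f → ¬ Subword f w) Forbidden →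
            (u : List Σ₂) → Subword u (g w) → IsSquare u → u ∈ AllowedSquares
theorem10 w squarefree avoids .(x ++ x) (p , s , eq) (x , x≢[] , refl)
  with k , p′ , eq′ , _ , |p′|<6 ← h*-realign w {p} {(x ++ x) ++ s} eq
  with valid′ ← valid-subword (drop-subword k w) (squarefree , avoids)
  with length x ≤? 18
... | yes |x|≤18 = short-square-allowed {drop k w} {p′} {x} {s} valid′ eq′ |p′|<6 x≢[] |x|≤18
... | no  |x|≰18 = ⊥-elim (long-square-impossible {drop k w} {p′} {x} {s} valid′ eq′ |p′|<6 (≰⇒> |x|≰18))
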